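{- Let $n$ be a positive integer with $\gcd(n,6)=1$ and let $S=(x_1)(x_2)(x_3)(x_4)$ be a minimal zero-sum sequence over $\mathbb{Z}/n$ with integers $1\le x_i<n$. Suppose $\mathrm{ind}(S)=2$, $x_1=1$, $x_2+1=x_3$, and $\gcd(x_i,n)=1$ for all $i$. If $k$ is good, then $x_2\ge \left[\frac{6k-1}{6k}n\right]$.
   Context: $[\cdot]$ is the floor function. An integer $k$ is called good (relative to $n$) if: (i) $k=2^l$ for some integer $l\ge0$; (ii) $k<\frac{n}{6}$; (iii) $F(k):=\left(2n-2-2\left[\frac{3k-1}{3k}n\right]\right)k>\frac{n-1}{2}$. A sequence is minimal zero-sum if its terms sum to $0$ and no proper nontrivial subsequence sums to $0$. For a generator $g$ of $\mathbb{Z}/n$, writing $S=(y_1g)\cdots(y_4g)$ with $1\le y_i\le n$, the $g$-norm is $\|S\|_g=\frac{1}{n}\sum y_i$, and $\mathrm{ind}(S)=\min_g\|S\|_g$ over all generators $g$. -}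

module Defs where

open import Data.Nat using (ℕ; zero; suc; _+_; _*_; _∸_; _^_; _≤_; _<_; NonZero)
open import Data.Nat.DivMod using (_/_; _%_)
open import Data.Nat.Coprimality using (Coprime)
open import Data.Fin using (Fin; zero; suc)
open import Data.Fin.Subset using (Subset; _∈_; _∉_)
open import Data.Bool using (Bool; true; false; if_then_else_)
open import Data.Vec using (lookup)
open import Data.Product using (∃; _×_; Σ)
open import Relation.Binary.PropositionalEquality using (_≡_; _≢_)
open import Relation.Nullary using (¬_)

_≡_[mod_] : ℕ → ℕ → (n : ℕ) → .{{NonZero n}} → Set
a ≡ b [mod n ] = a % n ≡ b % n

sumFin : ∀ {m} → (Fin m → ℕ) → ℕ
sumFin {zero}  f = 0
sumFin {suc m} f = f zero + sumFin (λ i → f (suc i))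

sumSub : ∀ {m} → Subset m → (Fin m → ℕ) → ℕ
sumSub T x = sumFin (λ i → if lookup T i then x i else 0)

MinimalZeroSum : ∀ {m} (n : ℕ) → .{{NonZero n}} → (Fin m → ℕ) → Set
MinimalZeroSum {m} n x =
  (sumFin x ≡ 0 [mod n ]) ×
  (∀ (T : Subset m) → ∃ (λ i → i ∈ T) → ∃ (λ j → j ∉ T) →
     ¬ (sumSub T x ≡ 0 [mod n ]))

Generator : ℕ → ℕ → Set
Generator n g = (g < n) × Coprime g n

-- s = n · ||S||_g : s = Σ y_i where 1 ≤ y_i ≤ n and y_i g ≡ x_i (mod n)
IsNormSum : ∀ {m} (n : ℕ) → .{{NonZero n}} → ℕ → (Fin m → ℕ) → ℕ → Set
IsNormSum n g x s =
  Σ (Fin _ → ℕ) λ y →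
    (∀ i → (1 ≤ y i) × (y i ≤ n)) × (∀ i → (y i * g) ≡ (x i) [mod n ]) × (sumFin y ≡ s)

-- ind(S) = 2, i.e. min_g ||S||_g = 2, i.e. min_g Σ y_i = 2n
IndEqTwo : ∀ {m} (n : ℕ) → .{{NonZero n}} → (Fin m → ℕ) → Set
IndEqTwo n x =
  (∃ λ g → Generator n g × IsNormSum n g x (2 * n)) ×
  (∀ g s → Generator n g → IsNormSum n g x s → 2 * n ≤ s)

-- [ (3k-1) n / (3k) ]  (k ≥ 1 in all uses; we use suc-form to avoid NonZero)
floorFrac : ℕ → ℕ → ℕ → ℕ
floorFrac c k n = ((c * k ∸ 1) * n) / suc (c * k ∸ 1)

F : ℕ → ℕ → ℕ
F n k = (2 * n ∸ 2 ∸ 2 * floorFrac 3 k n) * k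

Good : ℕ → ℕ → Set
Good n k = (∃ λ l → k ≡ 2 ^ l) × (6 * k < n) × (n ∸ 1 < 2 * F n k)

module Submission where

-- Write S = (1)(a)(a+1)(x₃) with 1 ≤ xᵢ < n.  If m is a unit of ℤ/n and yᵢ ∈ [1,n]
-- represent m·xᵢ, then Σ yᵢ = n·‖S‖_g for the generator g = m⁻¹; hence ind(S) = 2
-- forces Σ yᵢ ≥ 2n for every such choice (scaled-norm-bound).
-- With m = 1 this gives Σ xᵢ ≥ 2n; as Σ xᵢ < 3n is a multiple of n, Σ xᵢ = 2n, that is
-- x₃ = 2c where n = a + 1 + c.  Suppose a < [(6k-1)n/(6k)].  This floor is at most n - 2
-- (floor-gap, using 6k < n), so c ≥ 2; minimality (x₀ + x₃ ≠ n) and n odd then give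
-- 2c + 3 ≤ n.  A dyadic search (doubling-bracket) locates n against 2c·2ᵉ, and in
-- every case a unit m made of 2s and 3s (or m = 5 when n = 17) falls into the window
-- n/(2c) < m < n/(c+1) (smooth-window).  For such m the numbers
-- (m, n - m(c+1), n - mc, 2mc - n) represent m·S and sum to n < 2n, a contradiction.

open import Defs
open import Data.Nat using (ℕ; _+_; _*_; _≤_; _<_; _≥_; NonZero)
open import Data.Nat.Coprimality using (Coprime)
open import Data.Fin using (Fin; zero; suc)
open import Relation.Binary.PropositionalEquality using (_≡_)
open import Data.Product using (_×_)

open import Data.Nat using (zero; suc; _^_; _∸_; _<?_; _≤?_; _≟_; z≤n; s≤s)
open import Data.Nat.Properties
open import Data.Nat.Divisibility using (_∣_; divides; ∣-trans; ∣1⇒≡1; ∣m+n∣m⇒∣n; ∣n⇒∣m*n; ∣m⇒∣m*n; m%n≡0⇒n∣m)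
open import Data.Nat.DivMod using (_/_; _%_; %-distribˡ-*; [m+kn]%n≡m%n; m%n%n≡m%n; m%n<n; m<n⇒m%n≡m; m≡m%n+[m/n]*n; m/n*n≤m)
open import Data.Nat.Coprimality using (coprime?; coprime-Bézout; coprime-factors; 1-coprimeTo)
open import Data.Nat.GCD using (module Bézout)
open import Data.Nat.Tactic.RingSolver using (solve; solve-∀)
open import Data.List using (_∷_; [])
open import Data.Vec using (here; there) renaming (_∷_ to _∷ᵛ_; [] to []ᵛ)
open import Data.Bool using (true; false)
open import Data.Product using (∃; _,_; proj₁; proj₂)
open import Data.Empty using (⊥-elim)
open import Relation.Nullary using (¬_; yes; no)
open import Relation.Nullary.Decidable using (from-yes)
open import Relation.Binary.PropositionalEquality using (refl; sym; trans; cong; cong₂; subst; module ≡-Reasoning)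

<-by-slack : ∀ {a b n} k → a + k ≡ b → b < n → a < n
<-by-slack {a} k refl b<n = ≤-<-trans (m≤m+n a k) b<n

odd-< : ∀ {n} q → ¬ 2 ∣ n → n ≤ 2 * q → n < 2 * q
odd-< q odd n≤2q = ≤∧≢⇒< n≤2q (λ n≡2q → odd (divides q (trans n≡2q (*-comm 2 q))))

double-≰ : ∀ n .{{_ : NonZero n}} → ¬ (2 * n ≤ n)
double-≰ n 2n≤n with *-cancelʳ-≤ 2 1 n (subst (2 * n ≤_) (sym (*-identityˡ n)) 2n≤n)
... | s≤s ()

term≤sumFin : ∀ {len} (f : Fin len → ℕ) i → f i ≤ sumFin f
term≤sumFin f zero    = m≤m+n (f zero) _
term≤sumFin f (suc i) = ≤-trans (term≤sumFin (λ j → f (suc j)) i) (m≤n+m _ (f zero))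

multiple-between-2n-3n : ∀ {n s} .{{_ : NonZero n}} → n ∣ s → 2 * n ≤ s → s < 3 * n → s ≡ 2 * n
multiple-between-2n-3n {n} (divides q refl) 2n≤qn qn<3n =
  cong (_* n) (≤-antisym (≤-pred (*-cancelʳ-< n q 3 qn<3n)) (*-cancelʳ-≤ 2 q n 2n≤qn))

floor-gap : ∀ K n → suc K < n → suc ((K * n) / suc K) < n
floor-gap K n K+1<n = *-cancelʳ-< (suc K) (suc Q) n (begin-strict
    suc Q * suc K      ≡⟨⟩
    suc K + Q * suc K  ≤⟨ +-monoʳ-≤ (suc K) (m/n*n≤m (K * n) (suc K)) ⟩
    suc K + K * n      <⟨ +-monoˡ-< (K * n) K+1<n ⟩
    suc K * n          ≡⟨ *-comm (suc K) n ⟩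
    n * suc K          ∎)
  where
  open ≤-Reasoning
  Q = (K * n) / suc K

≡-mod-by-multiples : ∀ {n} .{{_ : NonZero n}} {y z : ℕ} u v → y + u * n ≡ z + v * n → y ≡ z [mod n ]
≡-mod-by-multiples {n} {y} {z} u v eq = begin
    y % n            ≡⟨ sym ([m+kn]%n≡m%n y u n) ⟩
    (y + u * n) % n  ≡⟨ cong (_% n) eq ⟩
    (z + v * n) % n  ≡⟨ [m+kn]%n≡m%n z v n ⟩
    z % n            ∎
  where open ≡-Reasoning

*-≡-mod : ∀ {n} .{{_ : NonZero n}} {a b c d : ℕ} → a ≡ b [mod n ] → c ≡ d [mod n ] → (a * c) ≡ (b * d) [mod n ]
*-≡-mod {n} {a} {b} {c} {d} a≡b c≡d = begin
    (a * c) % n                ≡⟨ %-distribˡ-* a c n ⟩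
    ((a % n) * (c % n)) % n    ≡⟨ cong₂ (λ u v → (u * v) % n) a≡b c≡d ⟩
    ((b % n) * (d % n)) % n    ≡⟨ sym (%-distribˡ-* b d n) ⟩
    (b * d) % n                ∎
  where open ≡-Reasoning

unscale : ∀ {n} .{{_ : NonZero n}} {m g y x : ℕ} → (m * g) ≡ 1 [mod n ] → y ≡ (m * x) [mod n ] → (y * g) ≡ x [mod n ]
unscale {n} {m} {g} {y} {x} mg≡1 y≡mx = begin
    (y * g) % n        ≡⟨ *-≡-mod y≡mx refl ⟩
    (m * x * g) % n    ≡⟨ cong (_% n) (solve (m ∷ x ∷ g ∷ [])) ⟩
    (x * (m * g)) % n  ≡⟨ *-≡-mod {a = x} refl mg≡1 ⟩
    (x * 1) % n        ≡⟨ cong (_% n) (*-identityʳ x) ⟩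
    x % n              ∎
  where open ≡-Reasoning

bézout-inverse : ∀ n .{{_ : NonZero n}} {m} → Coprime m n → ∃ λ z → (m * z) ≡ 1 [mod n ]
bézout-inverse n {m} m⊥n with coprime-Bézout m⊥n
... | Bézout.+- x y 1+yn≡xm =
  x , ≡-mod-by-multiples 0 y (trans (+-identityʳ (m * x)) (trans (*-comm m x) (sym 1+yn≡xm)))
bézout-inverse (suc p) {m} m⊥n | Bézout.-+ x y 1+xm≡yn =
  -- m·x ≡ -1, so m·(x·p) = m·x·(p+1) - m·x ≡ 1
  x * p , ≡-mod-by-multiples y (m * x) (begin
    m * (x * p) + y * suc p    ≡⟨ cong (m * (x * p) +_) (sym 1+xm≡yn) ⟩
    m * (x * p) + (1 + x * m)  ≡⟨ solve (m ∷ x ∷ p ∷ []) ⟩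
    1 + m * x * suc p          ∎)
  where open ≡-Reasoning

inverse-generator : ∀ n .{{_ : NonZero n}} {m} → 1 < n → Coprime m n →
                    ∃ λ g → Generator n g × (m * g) ≡ 1 [mod n ]
inverse-generator n {m} 1<n m⊥n = g , (m%n<n z n , g⊥n) , mg≡1
  where
  z = proj₁ (bézout-inverse n m⊥n)
  g = z % n
  mg≡1 : (m * g) ≡ 1 [mod n ]
  mg≡1 = trans (*-≡-mod {a = m} refl (m%n%n≡m%n z n)) (proj₂ (bézout-inverse n m⊥n))
  -- m·g = q·n + 1, so a common divisor of g and n divides 1
  mg≡qn+1 : m * g ≡ (m * g / n) * n + 1
  mg≡qn+1 = trans (m≡m%n+[m/n]*n (m * g) n)
                  (trans (cong (_+ (m * g / n) * n) (trans mg≡1 (m<n⇒m%n≡m 1<n))) (+-comm 1 _))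
  g⊥n : Coprime g n
  g⊥n {d} (d∣g , d∣n) =
    ∣1⇒≡1 (∣m+n∣m⇒∣n (subst (d ∣_) mg≡qn+1 (∣n⇒∣m*n m d∣g)) (∣n⇒∣m*n (m * g / n) d∣n))

coprime-* : ∀ {a b n} → Coprime a n → Coprime b n → Coprime (a * b) n
coprime-* {a} {b} a⊥n b⊥n (d∣ab , d∣n) = b⊥n (coprime-factors a⊥n (d∣ab , ∣m⇒∣m*n b d∣n) , d∣n)

coprime-^ : ∀ {a n} → Coprime a n → ∀ e → Coprime (a ^ e) n
coprime-^ {n = n} a⊥n zero    = 1-coprimeTo n
coprime-^         a⊥n (suc e) = coprime-* a⊥n (coprime-^ a⊥n e)

doubling-bracket : ∀ {b n} → 0 < b → b < n → ∃ λ e → b * 2 ^ e < n × n ≤ 2 * (b * 2 ^ e)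
doubling-bracket {b} {n} b>0 b<n = search n 0 (subst (_< n) (sym (*-identityʳ b)) b<n) (m≤m+n n _)
  where
  doubled : ∀ P → 2 * (b * P) ≡ b * (2 * P)
  doubled P = solve (b ∷ P ∷ [])
  -- the fuel f bounds how far n may still lie above b·2ᵉ
  search : ∀ f e → b * 2 ^ e < n → n ≤ f + b * 2 ^ e → ∃ λ e → b * 2 ^ e < n × n ≤ 2 * (b * 2 ^ e)
  search zero    e below n≤B = ⊥-elim (<⇒≱ below n≤B)
  search (suc f) e below n≤f+1+B with n ≤? 2 * (b * 2 ^ e)
  ... | yes n≤2B = e , below , n≤2B
  ... | no  n≰2B = search f (suc e) (subst (_< n) (doubled (2 ^ e)) (≰⇒> n≰2B)) (begin
      n                    ≤⟨ n≤f+1+B ⟩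
      suc f + B            ≡⟨ sym (+-suc f B) ⟩
      f + suc B            ≤⟨ +-monoʳ-≤ f (+-monoˡ-≤ B (*-mono-≤ b>0 (m^n>0 2 e))) ⟩
      f + (B + B)          ≡⟨ cong (f +_) (trans (cong (B +_) (sym (+-identityʳ B))) (doubled (2 ^ e))) ⟩
      f + b * 2 ^ suc e    ∎)
    where
    open ≤-Reasoning
    B = b * 2 ^ e

InWindow : ℕ → ℕ → ℕ → Set
InWindow n c m = n < 2 * (m * c) × m * suc c < n

WindowUnit : ℕ → ℕ → Set
WindowUnit n c = ∃ λ m → Coprime m n × InWindow n c m

window-point : ∀ {n c lo hi} → lo < n → n < hi → ∀ m k → m * suc c + k ≡ lo → hi ≡ 2 * (m * c) → InWindow n c m
window-point lo<n n<hi m k lo≡ hi≡ = subst (_ <_) hi≡ n<hi , <-by-slack k lo≡ lo<n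

module SmoothWindow {n : ℕ} (n⊥6 : Coprime n 6) where

  odd : ¬ 2 ∣ n
  odd 2∣n with n⊥6 (2∣n , divides 3 refl)
  ... | ()

  not-3∣ : ¬ 3 ∣ n
  not-3∣ 3∣n with n⊥6 (3∣n , divides 2 refl)
  ... | ()

  2⊥n : Coprime 2 n
  2⊥n (d∣2 , d∣n) = n⊥6 (d∣n , ∣-trans d∣2 (divides 3 refl))

  3⊥n : Coprime 3 n
  3⊥n (d∣3 , d∣n) = n⊥6 (d∣n , ∣-trans d∣3 (divides 2 refl))

  -- at bracket scale 8t (16ct < n < 32ct, c = 2 + d) the window contains 16t when
  -- n > 24ct, 12t when 18ct < n < 24ct, and 9t otherwise
  window-at-scale-8t : ∀ d t → Coprime t n →
    2 * (2 + d) * (2 * (2 * (2 * t))) < n → n < 2 * (2 * (2 + d) * (2 * (2 * (2 * t)))) →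
    WindowUnit n (2 + d)
  window-at-scale-8t d t t⊥n lo hi with 2 * (12 * t * (2 + d)) <? n
  ... | yes 24ct<n = 16 * t , coprime-* (coprime-^ 2⊥n 4) t⊥n ,
    window-point {c = 2 + d} 24ct<n hi (16 * t) (8 * t * d) (solve (d ∷ t ∷ [])) (solve (d ∷ t ∷ []))
  ... | no 24ct≮n with 2 * (9 * t * (2 + d)) <? n
  ...   | yes 18ct<n = 12 * t , coprime-* (coprime-* (coprime-^ 2⊥n 2) 3⊥n) t⊥n ,
    window-point {c = 2 + d} 18ct<n (odd-< (12 * t * (2 + d)) odd (≮⇒≥ 24ct≮n)) (12 * t) (6 * t * d) (solve (d ∷ t ∷ [])) refl
  ...   | no 18ct≮n = 9 * t , coprime-* (coprime-^ 3⊥n 2) t⊥n ,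
    window-point {c = 2 + d} lo (odd-< (9 * t * (2 + d)) odd (≮⇒≥ 18ct≮n)) (9 * t) (7 * t * d + 5 * t) (solve (d ∷ t ∷ [])) refl

  -- a window unit for every dyadic bracket 2c·2ᵉ < n < 2·2c·2ᵉ (c = 2 + d); at scales
  -- e = 1, 2 the smaller candidate needs c ≥ 3 or, for c = 2, the exclusion of
  -- n = 9, 18 (3 ∣ n, 2 ∣ n) and the exceptional unit 5 for n = 17
  window-at-scale : ∀ d e → 2 * (2 + d) * 2 ^ e < n → n < 2 * (2 * (2 + d) * 2 ^ e) → 3 + 2 * (2 + d) ≤ n →
    WindowUnit n (2 + d)
  -- 2c < n < 4c: m = 2, as 2c + 2 < n
  window-at-scale d 0 lo hi room =
    2 , 2⊥n , window-point {c = 2 + d} room hi 2 0 (solve (d ∷ [])) (solve (d ∷ []))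
  -- 4c < n < 8c: m = 4 above 6c, otherwise m = 3
  window-at-scale d 1 lo hi room with 2 * (3 * (2 + d)) <? n
  ... | yes 6c<n = 4 , coprime-^ 2⊥n 2 , window-point {c = 2 + d} 6c<n hi 4 (2 * d) (solve (d ∷ [])) (solve (d ∷ []))
  ... | no 6c≮n with d
  ...   | zero   = 3 , 3⊥n , window-point {c = 2} 9<n n<6c 3 0 refl refl
    where
    9<n = ≤∧≢⇒< lo (λ 9≡n → not-3∣ (subst (3 ∣_) 9≡n (divides 3 refl)))
    n<6c = odd-< (3 * 2) odd (≮⇒≥ 6c≮n)
  ...   | suc d' = 3 , 3⊥n , window-point {c = 3 + d'} lo (odd-< (3 * (3 + d')) odd (≮⇒≥ 6c≮n)) 3 d' (solve (d' ∷ [])) refl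
  -- 8c < n < 16c: m = 8 above 12c, otherwise m = 6 (or m = 5 for n = 17)
  window-at-scale d 2 lo hi room with 2 * (6 * (2 + d)) <? n
  ... | yes 12c<n = 8 , coprime-^ 2⊥n 3 , window-point {c = 2 + d} 12c<n hi 8 (4 * d) (solve (d ∷ [])) (solve (d ∷ []))
  ... | no 12c≮n with d | n ≟ 17
  ...   | zero | yes refl = 5 , from-yes (coprime? 5 17) , from-yes (17 <? 20) , from-yes (15 <? 17)
  ...   | zero | no n≢17 = 6 , coprime-* 2⊥n 3⊥n , window-point {c = 2} 18<n n<12c 6 0 refl refl
    where
    17<n = ≤∧≢⇒< lo (λ 17≡n → n≢17 (sym 17≡n))
    18<n = ≤∧≢⇒< 17<n (λ 18≡n → odd (subst (2 ∣_) 18≡n (divides 9 refl)))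
    n<12c = odd-< (6 * 2) odd (≮⇒≥ 12c≮n)
  ...   | suc d' | _ = 6 , coprime-* 2⊥n 3⊥n ,
    window-point {c = 3 + d'} lo (odd-< (6 * (3 + d')) odd (≮⇒≥ 12c≮n)) 6 (2 * d') (solve (d' ∷ [])) refl
  window-at-scale d (suc (suc (suc e))) lo hi room = window-at-scale-8t d (2 ^ e) (coprime-^ 2⊥n e) lo hi

  smooth-window : ∀ {c} → 2 ≤ c → 3 + 2 * c ≤ n → WindowUnit n c
  smooth-window {suc (suc d)} (s≤s (s≤s z≤n)) room =
    let (e , lo , hi) = doubling-bracket {2 * (2 + d)} {n} (s≤s z≤n) (≤-trans (m≤n+m _ 2) room)
    in window-at-scale d e lo (odd-< (2 * (2 + d) * 2 ^ e) odd hi) room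

-- If m is a unit and y represents m·x termwise in [1,n], then Σ y is n·‖x‖_g for the
-- generator g = m⁻¹; so ind(x) = 2 bounds every such sum below by 2n.
scaled-norm-bound : ∀ {len} n .{{_ : NonZero n}} {x : Fin len → ℕ} → IndEqTwo n x → 1 < n →
  ∀ {m} → Coprime m n → (y : Fin len → ℕ) → (∀ i → 1 ≤ y i × y i ≤ n) →
  (∀ i → y i ≡ (m * x i) [mod n ]) → 2 * n ≤ sumFin y
scaled-norm-bound n ind 1<n {m} m⊥n y y-bounds y≡mx =
  let (g , g-gen , mg≡1) = inverse-generator n 1<n m⊥n
  in proj₂ ind g (sumFin y) g-gen (y , y-bounds , (λ i → unscale {m = m} mg≡1 (y≡mx i)) , refl)

-- the representatives (m, n - m(c+1), n - mc, 2mc - n), written through the gaps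
-- e₁ = n - m(c+1) - 1 and e₃ = 2mc - n - 1, sum to n
window-representatives-sum : ∀ n m c e₁ e₃ → suc (m * suc c) + e₁ ≡ n → suc n + e₃ ≡ 2 * (m * c) →
  m + (suc e₁ + ((suc e₁ + m) + (suc e₃ + 0))) ≡ n
window-representatives-sum n m c e₁ e₃ gap₁ gap₃ = +-cancelʳ-≡ n _ _ (begin
    m + (suc e₁ + ((suc e₁ + m) + (suc e₃ + 0))) + n  ≡⟨ solve (n ∷ m ∷ e₁ ∷ e₃ ∷ []) ⟩
    2 + 2 * m + 2 * e₁ + (suc n + e₃)                  ≡⟨ cong (2 + 2 * m + 2 * e₁ +_) gap₃ ⟩
    2 + 2 * m + 2 * e₁ + 2 * (m * c)                   ≡⟨ solve (m ∷ c ∷ e₁ ∷ []) ⟩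
    (suc (m * suc c) + e₁) + (suc (m * suc c) + e₁)    ≡⟨ cong₂ _+_ gap₁ gap₁ ⟩
    n + n                                              ∎)
  where open ≡-Reasoning

module FourTermSequence (n : ℕ) .{{_ : NonZero n}} (n⊥6 : Coprime n 6) (x : Fin 4 → ℕ)
  (x-bounds : ∀ i → 1 ≤ x i × x i < n) (minimal : MinimalZeroSum n x) (ind : IndEqTwo n x)
  (x₀≡1 : x zero ≡ 1) (x₁+1≡x₂ : x (suc zero) + 1 ≡ x (suc (suc zero))) where

  open ≡-Reasoning
  open SmoothWindow n⊥6 using (odd; smooth-window)

  a : ℕ
  a = x (suc zero)

  x₃ : ℕ
  x₃ = x (suc (suc (suc zero)))

  1<n : 1 < n
  1<n = ≤-<-trans (proj₁ (x-bounds (suc zero))) (proj₂ (x-bounds (suc zero)))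

  sum-shape : sumFin x ≡ (a + 1) + ((a + 1) + x₃)
  sum-shape = begin
    sumFin x                        ≡⟨ cong₂ (λ u v → u + (a + (v + (x₃ + 0)))) x₀≡1 (sym x₁+1≡x₂) ⟩
    1 + (a + ((a + 1) + (x₃ + 0)))  ≡⟨ regroup a x₃ ⟩
    (a + 1) + ((a + 1) + x₃)        ∎
    where
    regroup : ∀ u v → 1 + (u + ((u + 1) + (v + 0))) ≡ (u + 1) + ((u + 1) + v)
    regroup = solve-∀

  -- Σ x = 2n: it is a multiple of n, at least 2n by ind(S) = 2 (take m = 1), and below 3n
  sum≡2n : sumFin x ≡ 2 * n
  sum≡2n = multiple-between-2n-3n n∣sum (scaled-norm-bound n ind 1<n (1-coprimeTo n) x x-bounds′ x≡1·x) sum<3n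
    where
    n∣sum : n ∣ sumFin x
    n∣sum = m%n≡0⇒n∣m (sumFin x) n (trans (proj₁ minimal) (m<n⇒m%n≡m (<⇒≤ 1<n)))
    x-bounds′ : ∀ i → 1 ≤ x i × x i ≤ n
    x-bounds′ i = proj₁ (x-bounds i) , <⇒≤ (proj₂ (x-bounds i))
    x≡1·x : ∀ i → x i ≡ (1 * x i) [mod n ]
    x≡1·x i = cong (_% n) (sym (*-identityˡ (x i)))
    a+1<n : a + 1 < n
    a+1<n = subst (_< n) (sym x₁+1≡x₂) (proj₂ (x-bounds (suc (suc zero))))
    x₃<n+0 : x₃ < n + 0
    x₃<n+0 = subst (x₃ <_) (sym (+-identityʳ n)) (proj₂ (x-bounds (suc (suc (suc zero)))))
    sum<3n : sumFin x < 3 * n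
    sum<3n = subst (_< 3 * n) (sym sum-shape) (+-mono-< a+1<n (+-mono-< a+1<n x₃<n+0))

  last-term : ∀ c → a + 1 + c ≡ n → x₃ ≡ 2 * c
  last-term c a+1+c≡n = +-cancelˡ-≡ (2 * a + 2) _ _ (begin
    2 * a + 2 + x₃            ≡⟨ regroup a x₃ ⟩
    (a + 1) + ((a + 1) + x₃)  ≡⟨ sym sum-shape ⟩
    sumFin x                  ≡⟨ sum≡2n ⟩
    2 * n                     ≡⟨ cong (2 *_) (sym a+1+c≡n) ⟩
    2 * (a + 1 + c)           ≡⟨ distribute a c ⟩
    2 * a + 2 + 2 * c         ∎)
    where
    regroup : ∀ u v → 2 * u + 2 + v ≡ (u + 1) + ((u + 1) + v)
    regroup = solve-∀
    distribute : ∀ u v → 2 * (u + 1 + v) ≡ 2 * u + 2 + 2 * v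
    distribute = solve-∀

  -- 2c + 3 ≤ n: the pair x₀ + x₃ = 1 + 2c must not vanish by minimality, and n ≠ 2c + 2 is odd
  room : ∀ c → x₃ ≡ 2 * c → 3 + 2 * c ≤ n
  room c x₃≡2c = ≤∧≢⇒< 2+2c≤n (λ 2+2c≡n → odd (divides (suc c) (trans (sym 2+2c≡n) (solve (c ∷ [])))))
    where
    T = true ∷ᵛ false ∷ᵛ false ∷ᵛ true ∷ᵛ []ᵛ
    pair-vanishes : 1 + 2 * c ≡ n → sumSub T x ≡ 0 [mod n ]
    pair-vanishes 1+2c≡n = ≡-mod-by-multiples 0 1 (begin
      x zero + (0 + (0 + (x₃ + 0))) + 0  ≡⟨ cong₂ (λ u v → u + (v + 0) + 0) x₀≡1 x₃≡2c ⟩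
      1 + (2 * c + 0) + 0                ≡⟨ solve (c ∷ []) ⟩
      1 + 2 * c                          ≡⟨ 1+2c≡n ⟩
      n                                  ≡⟨ solve (n ∷ []) ⟩
      0 + 1 * n                          ∎)
    2+2c≤n : 2 + 2 * c ≤ n
    2+2c≤n = ≤∧≢⇒< (subst (_< n) x₃≡2c (proj₂ (x-bounds (suc (suc (suc zero))))))
      (λ 1+2c≡n → proj₂ minimal T (zero , here) (suc zero , λ { (there ()) }) (pair-vanishes 1+2c≡n))

  -- a unit m in the window of (n, c) yields representatives
  -- (m, n - m(c+1), n - mc, 2mc - n) of m·S summing to n < 2n
  no-window-unit : ∀ c → a + 1 + c ≡ n → x₃ ≡ 2 * c → ¬ WindowUnit n c
  no-window-unit c a+1+c≡n x₃≡2c (m , m⊥n , n<2mc , m[c+1]<n) =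
    double-≰ n (subst (2 * n ≤_) y-sum (scaled-norm-bound n ind 1<n m⊥n y y-bounds y≡m·x))
    where
    e₁ = proj₁ (m≤n⇒∃[o]m+o≡n m[c+1]<n)
    gap₁ : suc (m * suc c) + e₁ ≡ n
    gap₁ = proj₂ (m≤n⇒∃[o]m+o≡n m[c+1]<n)
    e₃ = proj₁ (m≤n⇒∃[o]m+o≡n n<2mc)
    gap₃ : suc n + e₃ ≡ 2 * (m * c)
    gap₃ = proj₂ (m≤n⇒∃[o]m+o≡n n<2mc)

    y : Fin 4 → ℕ
    y zero                   = m
    y (suc zero)             = suc e₁
    y (suc (suc zero))       = suc e₁ + m
    y (suc (suc (suc zero))) = suc e₃

    y-sum : sumFin y ≡ n
    y-sum = window-representatives-sum n m c e₁ e₃ gap₁ gap₃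

    y-positive : ∀ i → 1 ≤ y i
    y-positive zero                   = n≢0⇒n>0 (λ m≡0 → n≮0 (subst (λ k → n < 2 * (k * c)) m≡0 n<2mc))
    y-positive (suc zero)             = s≤s z≤n
    y-positive (suc (suc zero))       = s≤s z≤n
    y-positive (suc (suc (suc zero))) = s≤s z≤n

    y-bounds : ∀ i → 1 ≤ y i × y i ≤ n
    y-bounds i = y-positive i , subst (y i ≤_) y-sum (term≤sumFin y i)

    -- y₁ ≡ m·a and y₂ ≡ m·(a+1), because a ≡ -(c+1) modulo n
    y₁≡m·a : suc e₁ ≡ (m * a) [mod n ]
    y₁≡m·a = ≡-mod-by-multiples m 1 (begin
      suc e₁ + m * n                     ≡⟨ cong (λ w → suc e₁ + m * w) (sym a+1+c≡n) ⟩
      suc e₁ + m * (a + 1 + c)           ≡⟨ regroup₁ e₁ m a c ⟩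
      m * a + 1 * (suc (m * suc c) + e₁) ≡⟨ cong (λ w → m * a + 1 * w) gap₁ ⟩
      m * a + 1 * n                      ∎)
      where
      regroup₁ : ∀ e₁ m a c → suc e₁ + m * (a + 1 + c) ≡ m * a + 1 * (suc (m * suc c) + e₁)
      regroup₁ = solve-∀
    y₂≡m·[a+1] : (suc e₁ + m) ≡ (m * (a + 1)) [mod n ]
    y₂≡m·[a+1] = ≡-mod-by-multiples m 1 (begin
      suc e₁ + m + m * n                       ≡⟨ cong (λ w → suc e₁ + m + m * w) (sym a+1+c≡n) ⟩
      suc e₁ + m + m * (a + 1 + c)             ≡⟨ regroup₂ e₁ m a c ⟩
      m * (a + 1) + 1 * (suc (m * suc c) + e₁) ≡⟨ cong (λ w → m * (a + 1) + 1 * w) gap₁ ⟩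
      m * (a + 1) + 1 * n                      ∎)
      where
      regroup₂ : ∀ e₁ m a c → suc e₁ + m + m * (a + 1 + c) ≡ m * (a + 1) + 1 * (suc (m * suc c) + e₁)
      regroup₂ = solve-∀
    y₃≡m·2c : suc e₃ ≡ (m * (2 * c)) [mod n ]
    y₃≡m·2c = ≡-mod-by-multiples 1 0 (begin
      suc e₃ + 1 * n      ≡⟨ regroup₃ e₃ n ⟩
      suc n + e₃          ≡⟨ gap₃ ⟩
      2 * (m * c)         ≡⟨ solve (m ∷ c ∷ n ∷ []) ⟩
      m * (2 * c) + 0 * n ∎)
      where
      regroup₃ : ∀ e₃ n → suc e₃ + 1 * n ≡ suc n + e₃
      regroup₃ = solve-∀

    y≡m·x : ∀ i → y i ≡ (m * x i) [mod n ]
    y≡m·x zero                   = cong (_% n) (trans (sym (*-identityʳ m)) (cong (m *_) (sym x₀≡1)))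
    y≡m·x (suc zero)             = y₁≡m·a
    y≡m·x (suc (suc zero))       = trans y₂≡m·[a+1] (cong (λ v → (m * v) % n) x₁+1≡x₂)
    y≡m·x (suc (suc (suc zero))) = trans y₃≡m·2c (cong (λ v → (m * v) % n) (sym x₃≡2c))

  -- the second term lies within 2 of n: otherwise a window unit would exist
  second-term-large : ¬ (3 + a ≤ n)
  second-term-large 3+a≤n = no-window-unit c a+1+c≡n x₃≡2c (smooth-window (s≤s (s≤s z≤n)) (room c x₃≡2c))
    where
    d = proj₁ (m≤n⇒∃[o]m+o≡n 3+a≤n)
    c = 2 + d
    a+1+c≡n : a + 1 + c ≡ n
    a+1+c≡n = trans (regroup a d) (proj₂ (m≤n⇒∃[o]m+o≡n 3+a≤n))
      where
      regroup : ∀ u v → u + 1 + (2 + v) ≡ 3 + u + v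
      regroup = solve-∀
    x₃≡2c : x₃ ≡ 2 * c
    x₃≡2c = last-term c a+1+c≡n

proposition1 : (n : ℕ) → .{{_ : NonZero n}} → Coprime n 6 →
    (x : Fin 4 → ℕ) → (∀ i → 1 ≤ x i × x i < n) →
    MinimalZeroSum n x → IndEqTwo n x →
    x zero ≡ 1 → x (suc zero) + 1 ≡ x (suc (suc zero)) →
    (∀ i → Coprime (x i) n) →
    (k : ℕ) → Good n k →
    x (suc zero) ≥ floorFrac 6 k n
proposition1 n n⊥6 x x-bounds minimal ind x₀≡1 x₁+1≡x₂ _ k ((l , k≡2^l) , 6k<n , _)
  with floorFrac 6 k n ≤? x (suc zero)
... | yes floor≤a = floor≤a
... | no  floor≰a = ⊥-elim (FourTermSequence.second-term-large n n⊥6 x x-bounds minimal ind x₀≡1 x₁+1≡x₂ 3+a≤n)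
  where
  6k≥1 : 1 ≤ 6 * k
  6k≥1 = ≤-trans (s≤s z≤n) (*-monoʳ-≤ 6 (subst (1 ≤_) (sym k≡2^l) (m^n>0 2 l)))
  6k<n′ : suc (6 * k ∸ 1) < n
  6k<n′ = subst (_< n) (sym (trans (+-comm 1 _) (m∸n+n≡m 6k≥1))) 6k<n
  -- a < [(6k-1)n/(6k)] ≤ n - 2
  3+a≤n : 3 + x (suc zero) ≤ n
  3+a≤n = ≤-trans (s≤s (s≤s (≰⇒> floor≰a))) (floor-gap (6 * k ∸ 1) n 6k<n′)
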